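{- Let $n$ be a positive integer and for integers $k\ge 0$ and $0\le j\le n$ let \[ c_{n,k}(j)=\sum_{i=0}^{k}(-1)^i(k+1-i)^{n-j}(k-i)^j\binom{n+1}{i} \] (with the convention $0^0=1$). Then: 1. $\sum_{k=0}^n c_{n,k}(j)=n!$ for every $0\le j\le n$; 2. $c_{n,k}(j)=c_{n,n-k}(n-j)$ for all $0\le j,k\le n$.
   Context: The numbers $c_{n,k}(j)$ are the coefficients in the expansion $\sum_{i=0}^{k}(-1)^i[(k+1-i)d-a]^n\binom{n+1}{i}=\sum_{j=0}^n c_{n,k}(j)\binom{n}{j}(d-a)^{n-j}a^j$ of the general Eulerian numbers $A_{n,k}(a,d)$. -}

module Defs where

open import Data.Nat as ℕ using (ℕ; zero; suc; _∸_)
open import Data.Nat.Combinatorics using (_C_)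
open import Data.Integer as ℤ using (ℤ; +_; -_)

sumTo : ℕ → (ℕ → ℤ) → ℤ
sumTo zero    f = f 0
sumTo (suc k) f = sumTo k f ℤ.+ f (suc k)

sign : ℕ → ℤ
sign zero    = + 1
sign (suc i) = - sign i

-- c_{n,k}(j) = Σ_{i=0}^{k} (-1)^i (k+1-i)^{n-j} (k-i)^j C(n+1,i)
-- For 0 ≤ i ≤ k the bases k+1-i and k-i are natural numbers, so truncated
-- subtraction is exact; ℕ's _^_ satisfies 0^0 = 1.
c : ℕ → ℕ → ℕ → ℤ
c n k j = sumTo k (λ i →
  sign i ℤ.* (+ (((suc k ∸ i) ℕ.^ (n ∸ j)) ℕ.* ((k ∸ i) ℕ.^ j) ℕ.* (suc n C i))))

module Submission where

-- Write  A_M[H](k) = Σ_{i ≤ k} (-1)^i H(k+1-i) C(M,i)  for a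
-- weight H on ℕ.  Then  c_{n,k}(j) = A_{n+1}[H_{n,j}](k)  with
-- H_{n,j}(m) = m^{n-j} (m-1)^j.  Pascal's rule together with the absorption
-- identity  (i+1) C(M,i+1) = (M-i) C(M,i)  shows, term by term, that multiplying
-- the weight by (m - e), e ∈ {0,1}, satisfies an Eulerian-type recurrence
--   A_{M+1}[(m-e)H](k) = (k+1-e) A_M[H](k) + (M-k+e) A_M[H](k-1).
-- Since H_{n+1,j} = m H_{n,j} (for j ≤ n) and H_{n+1,j+1} = (m-1) H_{n,j}, every
-- column k ↦ c_{n+1,k}(j) arises by this recurrence from a column of c_{n,·}.
-- Three facts about the recurrence then give everything by induction on n:
--   * it preserves vanishing beyond the top index, so c_{n,k}(j) = 0 for k > n;
--   * its weights add up to M, so the column sums get multiplied by n+1,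
--     giving  Σ_k c_{n,k}(j) = n!;
--   * the recurrences with e = 0 and e = 1 are exchanged by k ↦ n+1-k, which
--     propagates the symmetry  c_{n,k}(j) = c_{n,n-k}(n-j).

open import Defs
open import Data.Nat using (ℕ; _≤_; _∸_; _<_; _!)
open import Data.Integer using (ℤ; +_)
open import Data.Product using (_×_)
open import Relation.Binary.PropositionalEquality using (_≡_)

open import Data.Nat as ℕ using (zero; suc; z≤n; s≤s)
import Data.Nat.Properties as ℕP
open import Data.Nat.Combinatorics using (_C_; nC1≡n; nCk+nC[k+1]≡[n+1]C[k+1])
open import Data.Integer using (_+_; _*_; _-_; -_)
import Data.Integer.Properties as ℤP
open import Data.Integer.Tactic.RingSolver using (solve-∀)
open import Data.Product using (_,_; ∃₂)
open import Data.Sum using (inj₁; inj₂)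
open import Relation.Binary.PropositionalEquality
  using (refl; sym; trans; cong; cong₂; module ≡-Reasoning)
open import Algebra.Properties.CommutativeSemigroup ℕP.*-commutativeSemigroup
  using (x∙yz≈y∙xz)

open ≡-Reasoning

sumTo-cong : ∀ k {f g : ℕ → ℤ} → (∀ i → i ≤ k → f i ≡ g i) → sumTo k f ≡ sumTo k g
sumTo-cong zero    f≗g = f≗g 0 z≤n
sumTo-cong (suc k) f≗g =
  cong₂ _+_ (sumTo-cong k (λ i i≤k → f≗g i (ℕP.m≤n⇒m≤1+n i≤k))) (f≗g (suc k) ℕP.≤-refl)

sumTo-+ : ∀ k (f g : ℕ → ℤ) → sumTo k (λ i → f i + g i) ≡ sumTo k f + sumTo k g
sumTo-+ zero    f g = refl
sumTo-+ (suc k) f g = trans (cong (_+ (f (suc k) + g (suc k))) (sumTo-+ k f g))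
                            (interchange (sumTo k f) (sumTo k g) (f (suc k)) (g (suc k)))
  where
  interchange : ∀ (a b x y : ℤ) → (a + b) + (x + y) ≡ (a + x) + (b + y)
  interchange = solve-∀

sumTo-* : ∀ k (a : ℤ) (f : ℕ → ℤ) → sumTo k (λ i → a * f i) ≡ a * sumTo k f
sumTo-* zero    a f = refl
sumTo-* (suc k) a f =
  trans (cong (_+ a * f (suc k)) (sumTo-* k a f)) (sym (ℤP.*-distribˡ-+ a _ _))

sumTo-shift : ∀ k (f : ℕ → ℤ) → sumTo (suc k) f ≡ f 0 + sumTo k (λ i → f (suc i))
sumTo-shift zero    f = refl
sumTo-shift (suc k) f = trans (cong (_+ f (suc (suc k))) (sumTo-shift k f))
                              (ℤP.+-assoc (f 0) (sumTo k (λ i → f (suc i))) (f (suc (suc k))))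

prev : (ℕ → ℤ) → ℕ → ℤ
prev f zero    = + 0
prev f (suc k) = f k

sumTo-prev : ∀ k (f : ℕ → ℤ) → sumTo (suc k) (prev f) ≡ sumTo k f
sumTo-prev k f = trans (sumTo-shift k (prev f)) (ℤP.+-identityˡ (sumTo k f))

pos-∸ : ∀ {m n} → n ≤ m → + (m ∸ n) ≡ + m - + n
pos-∸ {m} {n} n≤m = sym (trans (ℤP.m-n≡m⊖n m n) (ℤP.⊖-≥ n≤m))

absorption : ∀ M k → + suc k * + (M C suc k) ≡ (+ M - + k) * + (M C k)
absorption zero    zero    = refl
absorption zero    (suc k) = trans (ℤP.*-zeroʳ (+ suc (suc k))) (sym (ℤP.*-zeroʳ (+ 0 - + suc k)))
absorption (suc M) zero    = trans (cong (λ z → + 1 * + z) (nC1≡n (suc M))) (identity (+ suc M))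
  where
  identity : ∀ x → + 1 * x ≡ (x - + 0) * + 1
  identity = solve-∀
absorption (suc M) (suc k) = begin
    + suc (suc k) * + (suc M C suc (suc k))
  ≡⟨ cong (+ suc (suc k) *_) (pascal (suc k)) ⟨
    + suc (suc k) * (+ B + + D)
  ≡⟨ step (+ k) (+ M) (+ A) (+ B) (+ D) (absorption M k) (absorption M (suc k)) ⟩
    (+ suc M - + suc k) * (+ A + + B)
  ≡⟨ cong ((+ suc M - + suc k) *_) (pascal k) ⟩
    (+ suc M - + suc k) * + (suc M C suc k)
  ∎
  where
  A B D : ℕ
  A = M C k
  B = M C suc k
  D = M C suc (suc k)
  pascal : ∀ i → + (M C i) + + (M C suc i) ≡ + (suc M C suc i)
  pascal i = trans (sym (ℤP.pos-+ (M C i) (M C suc i))) (cong +_ (nCk+nC[k+1]≡[n+1]C[k+1] M i))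
  step : ∀ (x y A B D : ℤ) → (+ 1 + x) * B ≡ (y - x) * A → (+ 2 + x) * D ≡ (y - (+ 1 + x)) * B →
    (+ 2 + x) * (B + D) ≡ ((+ 1 + y) - (+ 1 + x)) * (A + B)
  step x y A B D h₁ h₂ = trans (expand x A B D) (trans (cong₂ (λ u v → B + u + v) h₁ h₂) (collect x y A B))
    where
    expand : ∀ (x A B D : ℤ) → (+ 2 + x) * (B + D) ≡ B + (+ 1 + x) * B + (+ 2 + x) * D
    expand = solve-∀
    collect : ∀ (x y A B : ℤ) →
      B + (y - x) * A + (y - (+ 1 + x)) * B ≡ ((+ 1 + y) - (+ 1 + x)) * (A + B)
    collect = solve-∀

altSum : ℕ → (ℕ → ℕ) → ℕ → ℤ
altSum M H k = sumTo k (λ i → sign i * + (H (suc k ∸ i) ℕ.* (M C i)))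

record EulerianRecurrence (M e : ℕ) (f f' : ℕ → ℤ) : Set where
  constructor eulerian
  field
    recurrence : ∀ k → f' k ≡ (+ suc k - + e) * f k + (+ M - + k + + e) * prev f k

open EulerianRecurrence using (recurrence)

-- The algebraic core of one summand of the recurrence below: after Pascal's
-- rule C(M+1,i+1) = A + B, the absorption identity (i+1) B = (M-i) A is
-- exactly what is needed.  (Here k+1 = i + r + 1 and k+1-i = r+1.)
summand-identity : ∀ (σ g A B i r M e : ℤ) → (+ 1 + i) * B ≡ (M - i) * A →
  - σ * (((+ 1 + r) - e) * g * (A + B))
    ≡ ((+ 2 + (i + r)) - e) * (- σ * (g * B)) + ((M - (+ 1 + (i + r)) + e) * (σ * (g * A)))
summand-identity σ g A B i r M e absorb = begin
    - σ * (((+ 1 + r) - e) * g * (A + B))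
  ≡⟨ expand σ g A B i r M e ⟩
    R + σ * g * ((+ 1 + i) * B - (M - i) * A)
  ≡⟨ cong (λ z → R + σ * g * (z - (M - i) * A)) absorb ⟩
    R + σ * g * ((M - i) * A - (M - i) * A)
  ≡⟨ cancel R (σ * g) ((M - i) * A) ⟩
    R
  ∎
  where
  R : ℤ
  R = ((+ 2 + (i + r)) - e) * (- σ * (g * B)) + ((M - (+ 1 + (i + r)) + e) * (σ * (g * A)))
  expand : ∀ (σ g A B i r M e : ℤ) → - σ * (((+ 1 + r) - e) * g * (A + B))
    ≡ ((+ 2 + (i + r)) - e) * (- σ * (g * B)) + ((M - (+ 1 + (i + r)) + e) * (σ * (g * A)))
      + σ * g * ((+ 1 + i) * B - (M - i) * A)
  expand = solve-∀
  cancel : ∀ (R s x : ℤ) → R + s * (x - x) ≡ R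
  cancel = solve-∀

pos-∸-* : ∀ {m e} → e ≤ m → ∀ a b → + ((m ∸ e) ℕ.* a ℕ.* b) ≡ (+ m - + e) * + a * + b
pos-∸-* {m} {e} e≤m a b = begin
    + ((m ∸ e) ℕ.* a ℕ.* b)
  ≡⟨ ℤP.pos-* ((m ∸ e) ℕ.* a) b ⟩
    + ((m ∸ e) ℕ.* a) * + b
  ≡⟨ cong (_* + b) (ℤP.pos-* (m ∸ e) a) ⟩
    + (m ∸ e) * + a * + b
  ≡⟨ cong (λ z → z * + a * + b) (pos-∸ e≤m) ⟩
    (+ m - + e) * + a * + b
  ∎

suc-+-∸ : ∀ i r → suc (i ℕ.+ r) ∸ i ≡ suc r
suc-+-∸ i r = trans (cong (_∸ i) (sym (ℕP.+-suc i r))) (ℕP.m+n∸m≡n i (suc r))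

-- Termwise form of the recurrence: the i-th summand of A_{M+1}[(m-e)G](k)
-- splits into (k+1-e) times the i-th summand of A_M[G](k) plus (M-k+e) times
-- the (i-1)-th summand of A_M[G](k-1).
altSum-summand : ∀ M (G : ℕ → ℕ) e → e ≤ 1 → ∀ k i → i ≤ k →
  sign i * + ((suc k ∸ i ∸ e) ℕ.* G (suc k ∸ i) ℕ.* (suc M C i))
    ≡ (+ suc k - + e) * (sign i * + (G (suc k ∸ i) ℕ.* (M C i)))
      + (+ M - + k + + e) * prev (λ i → sign i * + (G (k ∸ i) ℕ.* (M C i))) i
altSum-summand M G e e≤1 k zero _ = begin
    + 1 * + ((suc k ∸ e) ℕ.* G (suc k) ℕ.* 1)
  ≡⟨ cong (+ 1 *_) (pos-∸-* (ℕP.≤-trans e≤1 (s≤s z≤n)) (G (suc k)) 1) ⟩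
    + 1 * ((+ suc k - + e) * + G (suc k) * + 1)
  ≡⟨ regroup (+ suc k - + e) (+ G (suc k)) (+ M - + k + + e) ⟩
    (+ suc k - + e) * (+ 1 * (+ G (suc k) * + 1)) + (+ M - + k + + e) * + 0
  ≡⟨ cong (λ z → (+ suc k - + e) * (+ 1 * z) + (+ M - + k + + e) * + 0) (ℤP.pos-* (G (suc k)) 1) ⟨
    (+ suc k - + e) * (+ 1 * + (G (suc k) ℕ.* 1)) + (+ M - + k + + e) * + 0
  ∎
  where
  regroup : ∀ s g β → + 1 * (s * g * + 1) ≡ s * (+ 1 * (g * + 1)) + β * + 0
  regroup = solve-∀
altSum-summand M G e e≤1 (suc k) (suc i) (s≤s i≤k) with ℕP.m≤n⇒∃[o]m+o≡n i≤k
... | r , refl rewrite suc-+-∸ i r | sym (nCk+nC[k+1]≡[n+1]C[k+1] M i) = begin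
    - σ * + ((suc r ∸ e) ℕ.* g ℕ.* (A ℕ.+ B))
  ≡⟨ cong (- σ *_) (pos-∸-* (ℕP.≤-trans e≤1 (s≤s z≤n)) g (A ℕ.+ B)) ⟩
    - σ * ((+ suc r - + e) * + g * + (A ℕ.+ B))
  ≡⟨ cong (λ z → - σ * ((+ suc r - + e) * + g * z)) (ℤP.pos-+ A B) ⟩
    - σ * ((+ suc r - + e) * + g * (+ A + + B))
  ≡⟨ summand-identity σ (+ g) (+ A) (+ B) (+ i) (+ r) (+ M) (+ e) (absorption M i) ⟩
    (+ suc (suc (i ℕ.+ r)) - + e) * (- σ * (+ g * + B))
      + (+ M - + suc (i ℕ.+ r) + + e) * (σ * (+ g * + A))
  ≡⟨ cong₂ (λ u v → (+ suc (suc (i ℕ.+ r)) - + e) * (- σ * u)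
                    + (+ M - + suc (i ℕ.+ r) + + e) * (σ * v))
           (ℤP.pos-* g B) (ℤP.pos-* g A) ⟨
    (+ suc (suc (i ℕ.+ r)) - + e) * (- σ * + (g ℕ.* B))
      + (+ M - + suc (i ℕ.+ r) + + e) * (σ * + (g ℕ.* A))
  ∎
  where
  σ : ℤ
  σ = sign i
  g A B : ℕ
  g = G (suc r)
  A = M C i
  B = M C suc i

altSum-shifted : ∀ M (G : ℕ → ℕ) k →
  sumTo k (prev (λ i → sign i * + (G (k ∸ i) ℕ.* (M C i)))) ≡ prev (altSum M G) k
altSum-shifted M G zero    = refl
altSum-shifted M G (suc k) = sumTo-prev k (λ i → sign i * + (G (suc k ∸ i) ℕ.* (M C i)))

altSum-recurrence : ∀ M (G : ℕ → ℕ) e → e ≤ 1 →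
  EulerianRecurrence M e (altSum M G) (altSum (suc M) (λ m → (m ∸ e) ℕ.* G m))
altSum-recurrence M G e e≤1 = eulerian at
  where
  at : ∀ k → altSum (suc M) (λ m → (m ∸ e) ℕ.* G m) k
    ≡ (+ suc k - + e) * altSum M G k + (+ M - + k + + e) * prev (altSum M G) k
  at k = begin
      altSum (suc M) (λ m → (m ∸ e) ℕ.* G m) k
    ≡⟨ sumTo-cong k (altSum-summand M G e e≤1 k) ⟩
      sumTo k (λ i → α * term i + β * shifted i)
    ≡⟨ sumTo-+ k (λ i → α * term i) (λ i → β * shifted i) ⟩
      sumTo k (λ i → α * term i) + sumTo k (λ i → β * shifted i)
    ≡⟨ cong₂ _+_ (sumTo-* k α term) (sumTo-* k β shifted) ⟩
      α * altSum M G k + β * sumTo k shifted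
    ≡⟨ cong (λ z → α * altSum M G k + β * z) (altSum-shifted M G k) ⟩
      α * altSum M G k + β * prev (altSum M G) k
    ∎
    where
    α β : ℤ
    α = + suc k - + e
    β = + M - + k + + e
    term : ℕ → ℤ
    term i = sign i * + (G (suc k ∸ i) ℕ.* (M C i))
    shifted : ℕ → ℤ
    shifted = prev (λ i → sign i * + (G (k ∸ i) ℕ.* (M C i)))

recurrence-support : ∀ {M e f f'} n → EulerianRecurrence M e f f' →
  (∀ k → n < k → f k ≡ + 0) → ∀ k → suc n < k → f' k ≡ + 0
recurrence-support {M} {e} {f} {f'} n rec f-zero (suc k) (s≤s n<k) = begin
    f' (suc k)
  ≡⟨ recurrence rec (suc k) ⟩
    α * f (suc k) + β * f k
  ≡⟨ cong₂ (λ u v → α * u + β * v) (f-zero (suc k) (ℕP.m<n⇒m<1+n n<k)) (f-zero k n<k) ⟩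
    α * + 0 + β * + 0
  ≡⟨ annihilate α β ⟩
    + 0
  ∎
  where
  α β : ℤ
  α = + suc (suc k) - + e
  β = + M - + suc k + + e
  annihilate : ∀ (a b : ℤ) → a * + 0 + b * + 0 ≡ + 0
  annihilate = solve-∀

-- The weights of the recurrence add up to M, so if f is supported on [0, M-1]
-- the sum of f' over [0, M] is M times the sum of f.
recurrence-sum : ∀ {e f f'} n → EulerianRecurrence (suc n) e f f' → f (suc n) ≡ + 0 →
  sumTo (suc n) f' ≡ + suc n * sumTo n f
recurrence-sum {e} {f} {f'} n rec f-top = begin
    sumTo (suc n) f'
  ≡⟨ sumTo-cong (suc n) (λ k _ → recurrence rec k) ⟩
    sumTo (suc n) (λ k → α k * f k + β k * prev f k)
  ≡⟨ sumTo-+ (suc n) (λ k → α k * f k) (λ k → β k * prev f k) ⟩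
    (sumTo n (λ k → α k * f k) + α (suc n) * f (suc n)) + sumTo (suc n) (λ k → β k * prev f k)
  ≡⟨ cong₂ (λ u v → (sumTo n (λ k → α k * f k) + α (suc n) * u) + v)
           f-top (sumTo-shift n (λ k → β k * prev f k)) ⟩
    (sumTo n (λ k → α k * f k) + α (suc n) * + 0) + (β 0 * + 0 + sumTo n (λ k → β (suc k) * f k))
  ≡⟨ drop-zeros (sumTo n (λ k → α k * f k)) (α (suc n)) (β 0) (sumTo n (λ k → β (suc k) * f k)) ⟩
    sumTo n (λ k → α k * f k) + sumTo n (λ k → β (suc k) * f k)
  ≡⟨ sumTo-+ n (λ k → α k * f k) (λ k → β (suc k) * f k) ⟨
    sumTo n (λ k → α k * f k + β (suc k) * f k)
  ≡⟨ sumTo-cong n (λ k _ → weights-add (+ suc k) (+ suc n) (+ e) (f k)) ⟩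
    sumTo n (λ k → + suc n * f k)
  ≡⟨ sumTo-* n (+ suc n) f ⟩
    + suc n * sumTo n f
  ∎
  where
  α β : ℕ → ℤ
  α k = + suc k - + e
  β k = + suc n - + k + + e
  drop-zeros : ∀ (a b x y : ℤ) → (a + b * + 0) + (x * + 0 + y) ≡ a + y
  drop-zeros = solve-∀
  weights-add : ∀ (a b ε X : ℤ) → (a - ε) * X + (b - a + ε) * X ≡ b * X
  weights-add = solve-∀

reflect-prev : ∀ n (f g : ℕ → ℤ) → (∀ k → k ≤ n → f (n ∸ k) ≡ g k) → f (suc n) ≡ + 0 →
  ∀ k → k ≤ suc n → f (suc n ∸ k) ≡ prev g k
reflect-prev n f g f-refl f-top zero    _           = f-top
reflect-prev n f g f-refl f-top (suc k) (s≤s k≤n) = f-refl k k≤n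

reflect-sym : ∀ n (f g : ℕ → ℤ) → (∀ k → k ≤ n → f (n ∸ k) ≡ g k) →
  ∀ k → k ≤ n → g (n ∸ k) ≡ f k
reflect-sym n f g f-refl k k≤n =
  trans (sym (f-refl (n ∸ k) (ℕP.m∸n≤m n k))) (cong f (ℕP.m∸[m∸n]≡n k≤n))

prev-reflect : ∀ n (f g : ℕ → ℤ) → (∀ k → k ≤ n → f (n ∸ k) ≡ g k) → g (suc n) ≡ + 0 →
  ∀ k → k ≤ suc n → prev f (suc n ∸ k) ≡ g k
prev-reflect n f g f-refl g-top k k≤n+1 =
  trans (sym (reflect-prev n g f (reflect-sym n f g f-refl) g-top (suc n ∸ k) (ℕP.m∸n≤m (suc n) k)))
        (cong g (ℕP.m∸[m∸n]≡n k≤n+1))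

recurrence-reflect : ∀ n {f g f' g'} → EulerianRecurrence (suc n) 0 f f' →
  EulerianRecurrence (suc n) 1 g g' → (∀ k → k ≤ n → f (n ∸ k) ≡ g k) →
  f (suc n) ≡ + 0 → g (suc n) ≡ + 0 → ∀ k → k ≤ suc n → f' k ≡ g' (suc n ∸ k)
recurrence-reflect n {f} {g} {f'} {g'} rec-f rec-g f-refl f-top g-top k k≤n+1 = begin
    f' k
  ≡⟨ recurrence rec-f k ⟩
    (+ suc k - + 0) * f k + (+ suc n - + k + + 0) * prev f k
  ≡⟨ exchange (+ k) (+ suc n) (f k) (prev f k) ⟩
    ((+ 1 + (+ suc n - + k)) - + 1) * prev f k + (+ suc n - (+ suc n - + k) + + 1) * f k
  ≡⟨ cong₂ (λ u v → ((+ 1 + u) - + 1) * prev f k + (+ suc n - u + + 1) * v)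
           (sym (pos-∸ k≤n+1)) (sym (prev-reflect n g f g-refl f-top k k≤n+1)) ⟩
    (+ suc (suc n ∸ k) - + 1) * prev f k + (+ suc n - + (suc n ∸ k) + + 1) * prev g (suc n ∸ k)
  ≡⟨ cong (λ z → (+ suc (suc n ∸ k) - + 1) * z + (+ suc n - + (suc n ∸ k) + + 1) * prev g (suc n ∸ k))
          (sym (reflect-prev n g f g-refl g-top k k≤n+1)) ⟩
    (+ suc (suc n ∸ k) - + 1) * g (suc n ∸ k) + (+ suc n - + (suc n ∸ k) + + 1) * prev g (suc n ∸ k)
  ≡⟨ recurrence rec-g (suc n ∸ k) ⟨
    g' (suc n ∸ k)
  ∎
  where
  g-refl : ∀ k → k ≤ n → g (n ∸ k) ≡ f k
  g-refl = reflect-sym n f g f-refl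
  exchange : ∀ (a b X Y : ℤ) → ((+ 1 + a) - + 0) * X + (b - a + + 0) * Y
    ≡ ((+ 1 + (b - a)) - + 1) * Y + (b - (b - a) + + 1) * X
  exchange = solve-∀

column : ℕ → ℕ → ℕ → ℤ
column n j k = c n k j

eulerWeight : ℕ → ℕ → ℕ → ℕ
eulerWeight n j m = (m ℕ.^ (n ∸ j)) ℕ.* ((m ∸ 1) ℕ.^ j)

column≡altSum : ∀ n j k → column n j k ≡ altSum (suc n) (eulerWeight n j) k
column≡altSum n j k = sumTo-cong k (λ i _ →
  cong (λ z → sign i * + ((suc k ∸ i) ℕ.^ (n ∸ j) ℕ.* z ℕ.^ j ℕ.* (suc n C i))) (sym (pred-diff i)))
  where
  pred-diff : ∀ i → suc k ∸ i ∸ 1 ≡ k ∸ i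
  pred-diff i = trans (ℕP.∸-+-assoc (suc k) i 1) (cong (suc k ∸_) (ℕP.+-comm i 1))

eulerWeight-lower : ∀ {n j} → j ≤ n → ∀ m →
  eulerWeight (suc n) j m ≡ (m ∸ 0) ℕ.* eulerWeight n j m
eulerWeight-lower {n} {j} j≤n m rewrite ℕP.+-∸-assoc 1 j≤n =
  ℕP.*-assoc m (m ℕ.^ (n ∸ j)) ((m ∸ 1) ℕ.^ j)

eulerWeight-raise : ∀ n j m → eulerWeight (suc n) (suc j) m ≡ (m ∸ 1) ℕ.* eulerWeight n j m
eulerWeight-raise n j m = x∙yz≈y∙xz (m ℕ.^ (n ∸ j)) (m ∸ 1) ((m ∸ 1) ℕ.^ j)

column-recurrence : ∀ n j j' e → e ≤ 1 →
  (∀ m → eulerWeight (suc n) j' m ≡ (m ∸ e) ℕ.* eulerWeight n j m) →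
  EulerianRecurrence (suc n) e (column n j) (column (suc n) j')
column-recurrence n j j' e e≤1 weight = eulerian at
  where
  at : ∀ k → column (suc n) j' k
    ≡ (+ suc k - + e) * column n j k + (+ suc n - + k + + e) * prev (column n j) k
  at k = begin
      column (suc n) j' k
    ≡⟨ column≡altSum (suc n) j' k ⟩
      altSum (suc (suc n)) (eulerWeight (suc n) j') k
    ≡⟨ sumTo-cong k (λ i _ → cong (λ z → sign i * + (z ℕ.* (suc (suc n) C i))) (weight (suc k ∸ i))) ⟩
      altSum (suc (suc n)) (λ m → (m ∸ e) ℕ.* eulerWeight n j m) k
    ≡⟨ recurrence (altSum-recurrence (suc n) (eulerWeight n j) e e≤1) k ⟩
      (+ suc k - + e) * altSum (suc n) (eulerWeight n j) k
        + (+ suc n - + k + + e) * prev (altSum (suc n) (eulerWeight n j)) k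
    ≡⟨ cong₂ (λ u v → (+ suc k - + e) * u + (+ suc n - + k + + e) * v)
             (sym (column≡altSum n j k)) (sym (prev-column k)) ⟩
      (+ suc k - + e) * column n j k + (+ suc n - + k + + e) * prev (column n j) k
    ∎
    where
    prev-column : ∀ k → prev (column n j) k ≡ prev (altSum (suc n) (eulerWeight n j)) k
    prev-column zero    = refl
    prev-column (suc k) = column≡altSum n j k

column-lower : ∀ {n j} → j ≤ n → EulerianRecurrence (suc n) 0 (column n j) (column (suc n) j)
column-lower {n} {j} j≤n = column-recurrence n j j 0 z≤n (eulerWeight-lower j≤n)

column-raise : ∀ n j → EulerianRecurrence (suc n) 1 (column n j) (column (suc n) (suc j))
column-raise n j = column-recurrence n j (suc j) 1 (s≤s z≤n) (eulerWeight-raise n j)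

column-step : ∀ n j → j ≤ suc n →
  ∃₂ λ j₀ e → j₀ ≤ n × EulerianRecurrence (suc n) e (column n j₀) (column (suc n) j)
column-step n zero    _           = 0 , 0 , z≤n , column-lower z≤n
column-step n (suc j) (s≤s j≤n) = j , 1 , j≤n , column-raise n j

-- c_{n,k}(j) = 0 for k > n.  For n = 0 only the summands i = 0, 1 survive
-- and they cancel; the step is recurrence-support.
column-vanishes : ∀ n j → j ≤ n → ∀ k → n < k → column n j k ≡ + 0
column-vanishes zero    zero    z≤n (suc k) _ = base k
  where
  base : ∀ k → c 0 (suc k) 0 ≡ + 0
  base zero    = refl
  base (suc k) = cong₂ _+_ (base k) (ℤP.*-zeroʳ (sign (suc (suc k))))
column-vanishes (suc n) j j≤n+1 with column-step n j j≤n+1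
... | j₀ , e , j₀≤n , rec = recurrence-support n rec (column-vanishes n j₀ j₀≤n)

column-sum : ∀ n j → j ≤ n → sumTo n (column n j) ≡ + (n !)
column-sum zero    zero    z≤n = refl
column-sum (suc n) j j≤n+1 with column-step n j j≤n+1
... | j₀ , e , j₀≤n , rec = begin
    sumTo (suc n) (column (suc n) j)
  ≡⟨ recurrence-sum n rec (column-vanishes n j₀ j₀≤n (suc n) ℕP.≤-refl) ⟩
    + suc n * sumTo n (column n j₀)
  ≡⟨ cong (+ suc n *_) (column-sum n j₀ j₀≤n) ⟩
    + suc n * + (n !)
  ≡⟨ ℤP.pos-* (suc n) (n !) ⟨
    + (suc n !)
  ∎

-- Inductive step for the symmetry in the columns j ≤ n: columns j and n-j of
-- c_{n+1} come from columns j and n-j of c_n, which are reflections of each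
-- other by hypothesis.
symmetric-step : ∀ n → (∀ j k → j ≤ n → k ≤ n → c n k j ≡ c n (n ∸ k) (n ∸ j)) →
  ∀ j k → j ≤ n → k ≤ suc n → c (suc n) k j ≡ c (suc n) (suc n ∸ k) (suc n ∸ j)
symmetric-step n symmetric j k j≤n k≤n+1 = begin
    c (suc n) k j
  ≡⟨ recurrence-reflect n (column-lower j≤n) (column-raise n (n ∸ j))
       (λ k k≤n → trans (symmetric j (n ∸ k) j≤n (ℕP.m∸n≤m n k))
                          (cong (λ z → c n z (n ∸ j)) (ℕP.m∸[m∸n]≡n k≤n)))
       (column-vanishes n j j≤n (suc n) ℕP.≤-refl)
       (column-vanishes n (n ∸ j) (ℕP.m∸n≤m n j) (suc n) ℕP.≤-refl) k k≤n+1 ⟩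
    c (suc n) (suc n ∸ k) (suc (n ∸ j))
  ≡⟨ cong (c (suc n) (suc n ∸ k)) (ℕP.+-∸-assoc 1 j≤n) ⟨
    c (suc n) (suc n ∸ k) (suc n ∸ j)
  ∎

column-symmetric : ∀ n j k → j ≤ n → k ≤ n → c n k j ≡ c n (n ∸ k) (n ∸ j)
column-symmetric zero    zero    zero    z≤n z≤n = refl
column-symmetric (suc n) j k j≤n+1 k≤n+1 with ℕP.m≤n⇒m<n∨m≡n j≤n+1
... | inj₁ (s≤s j≤n) = symmetric-step n (column-symmetric n) j k j≤n k≤n+1
-- The top column j = n+1 is the reflection of column 0.
... | inj₂ refl = begin
    c (suc n) k (suc n)
  ≡⟨ cong (λ z → c (suc n) z (suc n)) (ℕP.m∸[m∸n]≡n k≤n+1) ⟨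
    c (suc n) (suc n ∸ (suc n ∸ k)) (suc n)
  ≡⟨ symmetric-step n (column-symmetric n) 0 (suc n ∸ k) z≤n (ℕP.m∸n≤m (suc n) k) ⟨
    c (suc n) (suc n ∸ k) 0
  ≡⟨ cong (c (suc n) (suc n ∸ k)) (ℕP.n∸n≡0 n) ⟨
    c (suc n) (suc n ∸ k) (suc n ∸ suc n)
  ∎

theorem2p7 : (n : ℕ) → 0 < n →
    ((j : ℕ) → j ≤ n → sumTo n (λ k → c n k j) ≡ + (n !))
    × ((j k : ℕ) → j ≤ n → k ≤ n → c n k j ≡ c n (n ∸ k) (n ∸ j))
theorem2p7 n _ = column-sum n , column-symmetric n
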